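{- The $\mathcal{OBDD}$ size of $F_n$ is $2^{\Omega(n)}$.
   Context: For $i\in\{0,\dots,n\}$, $E^i_n(x_1,\dots,x_n)$ is the boolean function that is true exactly when $x_1+\cdots+x_n=i$. Define $P_0\equiv E^0_n$, $P_n\equiv E^n_n$, and for $i=1,\dots,n-1$: $P_{i,0}\equiv E^i_n\wedge\neg x_i$, $P_{i,1}\equiv E^i_n\wedge x_i$. With fresh variables $y_0,\dots,y_n$, $F_n(x_1,\dots,x_n,y_0,\dots,y_n)$ is $(P_0\wedge\neg y_0)\vee(P_n\wedge y_n)\vee\bigvee_{i=1}^{n-1}\big((P_{i,0}\wedge\neg y_i)\vee(P_{i,1}\wedge y_i)\big)$. $\mathcal{OBDD}$ denotes the class of (reduced) ordered binary decision diagrams over any variable ordering, where size is the number of arcs in the circuit obtained by representing each decision node on variable $x$ with children $A,B$ as $(\neg x\wedge A)\vee(x\wedge B)$ (equivalently, compressed SDDs respecting a right-linear vtree). The $\mathcal{OBDD}$ size of a function is the minimum size of an OBDD computing it. -}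

module Defs where

open import Data.Nat using (ℕ; zero; suc; _+_; _*_; _∸_; _<_; _≡ᵇ_)
open import Data.Bool using (Bool; true; false; _∧_; _∨_; not; if_then_else_)
open import Data.Fin using (Fin; zero; suc)
open import Data.Sum using (_⊎_; inj₁; inj₂)
open import Data.Product using (_×_)
open import Data.Unit using (⊤)
open import Data.Maybe using (Maybe; just; nothing; maybe)
open import Data.List using (List; map; allFin; upTo)
open import Data.Nat.ListAction using (sum)
open import Data.Bool.ListAction using (or)
open import Function.Definitions using (Injective)
open import Relation.Binary.PropositionalEquality using (_≡_)

-- Variables of F_n: inj₁ i is x_{i+1} (i : Fin n), inj₂ j is y_j (j : Fin (n+1)).
Var : ℕ → Set
Var n = Fin n ⊎ Fin (suc n)

toFin : (n i : ℕ) → Maybe (Fin n)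
toFin zero    i       = nothing
toFin (suc n) zero    = just zero
toFin (suc n) (suc i) = maybe (λ f → just (suc f)) nothing (toFin n i)

module _ (n : ℕ) (ρ : Var n → Bool) where
  -- x_i for 1 ≤ i ≤ n
  xv : ℕ → Bool
  xv zero    = false
  xv (suc i) = maybe (λ f → ρ (inj₁ f)) false (toFin n i)

  yv : ℕ → Bool
  yv i = maybe (λ f → ρ (inj₂ f)) false (toFin (suc n) i)

  xsum : ℕ
  xsum = sum (map (λ f → if ρ (inj₁ f) then 1 else 0) (allFin n))

  E : ℕ → Bool
  E i = xsum ≡ᵇ i

  P₀ Pₙ : Bool
  P₀ = E 0
  Pₙ = E n

  Pi0 Pi1 : ℕ → Bool
  Pi0 i = E i ∧ not (xv i)
  Pi1 i = E i ∧ xv i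

  middle : List ℕ
  middle = map suc (upTo (n ∸ 1))

F : (n : ℕ) → (Var n → Bool) → Bool
F n ρ = (P₀ n ρ ∧ not (yv n ρ 0)) ∨ ((Pₙ n ρ ∧ yv n ρ n) ∨
        or (map (λ i → (Pi0 n ρ i ∧ not (yv n ρ i)) ∨ (Pi1 n ρ i ∧ yv n ρ i)) (middle n ρ)))

-- A child of a node: a terminal (Bool) or one of the k previously built nodes.
Child : ℕ → Set
Child k = Bool ⊎ Fin k

record Node (V : Set) (k : ℕ) : Set where
  constructor node
  field
    var : V
    lo  : Child k
    hi  : Child k

-- A DAG of k decision nodes; the newest node has index zero,
-- and each node may only point to older nodes (so it is acyclic).
data Dag (V : Set) : ℕ → Set where
  []  : Dag V zero
  _∷_ : ∀ {k} → Node V k → Dag V k → Dag V (suc k)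

varAt : ∀ {V k} → Dag V k → Fin k → V
varAt (nd ∷ d) zero    = Node.var nd
varAt (nd ∷ d) (suc j) = varAt d j

vals : ∀ {V k} → Dag V k → (V → Bool) → Fin k → Bool
evalChild : ∀ {V k} → Dag V k → (V → Bool) → Child k → Bool
evalChild d ρ (inj₁ b) = b
evalChild d ρ (inj₂ j) = vals d ρ j
vals (nd ∷ d) ρ zero    =
  if ρ (Node.var nd) then evalChild d ρ (Node.hi nd) else evalChild d ρ (Node.lo nd)
vals (nd ∷ d) ρ (suc j) = vals d ρ j

ChildOK : ∀ {V k} → (V → ℕ) → Dag V k → V → Child k → Set
ChildOK rank d v (inj₁ b) = ⊤
ChildOK rank d v (inj₂ j) = rank v < rank (varAt d j)

Ordered : ∀ {V k} → (V → ℕ) → Dag V k → Set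
Ordered rank []       = ⊤
Ordered rank (nd ∷ d) =
  Ordered rank d × ChildOK rank d (Node.var nd) (Node.lo nd)
                 × ChildOK rank d (Node.var nd) (Node.hi nd)

-- An OBDD over variable set V: a variable ordering (injective rank function,
-- i.e. a total order on V), a DAG of decision nodes respecting it, and a root.
record OBDD (V : Set) : Set where
  field
    rank    : V → ℕ
    rankInj : Injective _≡_ _≡_ rank
    nodes   : ℕ
    dag     : Dag V nodes
    ordered : Ordered rank dag
    root    : Child nodes

Computes : ∀ {V} → OBDD V → ((V → Bool) → Bool) → Set
Computes {V} B f = (σ : V → Bool) → evalChild (OBDD.dag B) σ (OBDD.root B) ≡ f σ

-- size = number of arcs of the circuit where each decision node on x with
-- children A, B is (¬x ∧ A) ∨ (x ∧ B): 7 arcs per decision node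
-- (x→¬, ¬x→∧, A→∧, x→∧, B→∧, ∧→∨, ∧→∨).
size : ∀ {V} → OBDD V → ℕ
size B = 7 * OBDD.nodes B

-- Fooling set at a cut.  Cut the variable order of B so that exactly 8m of the
-- x-variables are early, m = ⌊n/16⌋; such a cut exists since moving the cut
-- makes variables early one at a time.  The evaluation of an assignment crosses
-- the cut at a child of B determined by its early part, and below the cut B
-- reads only late variables.  Hence early parts that are pairwise separated by
-- common late completions reach distinct children: there are at most
-- 2 + #nodes of them.  To separate 2^m early parts, take 2m early positions in
-- a suitable window, pair them up and code v ∈ {0,1}^m by x_a = v_j, x_b = ¬v_j
-- on the j-th pair (other early x fixed, all y off); all codes have the same
-- weight c.  If codes differ at position i, switching on i - c late
-- x-variables brings the x-sum to i, where F_n = (x_i ↔ y_i) = ¬x_i.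
-- A counting argument with two cases (many early positions below 8m, or many
-- above) finds the window; then 2^m ≤ 2 + #nodes yields 2^n ≤ (7·#nodes)^16.
module Submission where

open import Defs
open import Data.Nat using (ℕ; _≤_; _^_)
open import Data.Product using (∃-syntax)

open import Data.Nat
open import Data.Nat.Properties
open import Data.Nat.DivMod using (_/_; _%_; m≡m%n+[m/n]*n; m%n<n; m/n*n≤m; /-monoˡ-≤)
open import Data.Nat.Tactic.RingSolver using (solve-∀)
open import Data.Nat.ListAction using (sum)
open import Algebra.Properties.CommutativeSemigroup +-commutativeSemigroup using (interchange)
open import Data.Bool using (Bool; true; false; _∧_; _∨_; not; if_then_else_; T)
import Data.Bool as Bool
open import Data.Bool.Properties using (T?; T-≡; if-eta; not-injective; ∨-identityʳ; ∧-zeroʳ; ∧-identityʳ)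
open import Data.Bool.ListAction using (or; any)
open import Data.Fin using (Fin; zero; suc; toℕ; splitAt; join)
import Data.Fin as Fin
import Data.Fin.Properties as Finₚ
open import Data.Vec using (Vec; []; _∷_)
import Data.Vec.Properties as Vecₚ
open import Data.Vec.Functional using () renaming (_∷_ to _∷ᶠ_)
open import Data.List using (List; []; _∷_; length; map; tabulate; filter; allFin)
open import Data.List.Properties using (map-cong)
open import Data.List.Membership.Propositional using (_∈_; _∉_)
open import Data.List.Membership.Propositional.Properties using (∈-map⁺; ∈-upTo⁺; ∈-filter⁻)
open import Data.List.Relation.Unary.Any using (here; there)
import Data.List.Relation.Unary.Any as Any
open import Data.List.Relation.Unary.Any.Properties using (any⁺)
import Data.List.Relation.Unary.All as All
open import Data.List.Relation.Unary.All.Properties using (All¬⇒¬Any)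
open import Data.List.Relation.Unary.AllPairs using (_∷_)
open import Data.List.Relation.Unary.Unique.Propositional using (Unique)
open import Data.List.Relation.Unary.Unique.Propositional.Properties using (filter⁺; allFin⁺)
open import Data.Maybe using (just)
open import Data.Sum using (_⊎_; inj₁; inj₂)
import Data.Sum.Properties as Sumₚ
open import Data.Product using (_×_; _,_; proj₁; proj₂)
open import Data.Unit using (⊤; tt)
open import Data.Empty using (⊥-elim)
open import Function using (_∘_)
open import Function.Bundles using (Equivalence)
open import Function.Definitions using (Injective)
open import Relation.Binary.PropositionalEquality
open import Relation.Nullary using (¬_; yes; no; does; contradiction)
open import Relation.Nullary.Decidable using (dec-true; dec-false)

ind : Bool → ℕ
ind true  = 1
ind false = 0

count : ∀ n → (Fin n → Bool) → ℕ
count zero    g = 0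
count (suc n) g = ind (g zero) + count n (g ∘ suc)

count-ext : ∀ n {g h : Fin n → Bool} → (∀ f → g f ≡ h f) → count n g ≡ count n h
count-ext zero    g≗h = refl
count-ext (suc n) g≗h = cong₂ _+_ (cong ind (g≗h zero)) (count-ext n (g≗h ∘ suc))

count-false : ∀ n → count n (λ _ → false) ≡ 0
count-false zero    = refl
count-false (suc n) = count-false n

count-true : ∀ n → count n (λ _ → true) ≡ n
count-true zero    = refl
count-true (suc n) = cong suc (count-true n)

count-cover : ∀ n (g g₁ g₂ : Fin n → Bool) → (∀ f → T (g f) → T (g₁ f) ⊎ T (g₂ f)) →
  count n g ≤ count n g₁ + count n g₂
count-cover zero    g g₁ g₂ cover = z≤n
count-cover (suc n) g g₁ g₂ cover =
  ≤-trans (+-mono-≤ (ind-cover (g zero) (g₁ zero) (g₂ zero) (cover zero))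
                    (count-cover n (g ∘ suc) (g₁ ∘ suc) (g₂ ∘ suc) (cover ∘ suc)))
          (≤-reflexive (interchange (ind (g₁ zero)) (ind (g₂ zero)) _ _))
  where
  ind-cover : ∀ b b₁ b₂ → (T b → T b₁ ⊎ T b₂) → ind b ≤ ind b₁ + ind b₂
  ind-cover false b₁    b₂    _ = z≤n
  ind-cover true  true  b₂    _ = s≤s z≤n
  ind-cover true  false true  _ = s≤s z≤n
  ind-cover true  false false h with h tt
  ... | inj₁ ()
  ... | inj₂ ()

count-split : ∀ n (P g : Fin n → Bool) →
  count n g ≡ count n (λ f → P f ∧ g f) + count n (λ f → not (P f) ∧ g f)
count-split zero    P g = refl
count-split (suc n) P g =
  trans (cong₂ _+_ (ind-split (P zero) (g zero)) (count-split n (P ∘ suc) (g ∘ suc)))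
        (interchange (ind (P zero ∧ g zero)) _ _ _)
  where
  ind-split : ∀ p b → ind b ≡ ind (p ∧ b) + ind (not p ∧ b)
  ind-split true  b = sym (+-identityʳ _)
  ind-split false b = refl

count-unique : ∀ n (g : Fin n → Bool) → (∀ f₁ f₂ → T (g f₁) → T (g f₂) → f₁ ≡ f₂) →
  count n g ≤ 1
count-unique zero    g uniq = z≤n
count-unique (suc n) g uniq with g zero in g₀
... | false = count-unique n (g ∘ suc) (λ f₁ f₂ p q → Finₚ.suc-injective (uniq (suc f₁) (suc f₂) p q))
... | true  = s≤s (≤-reflexive (trans (count-ext n no-other) (count-false n)))
  where
  no-other : ∀ f → g (suc f) ≡ false
  no-other f with g (suc f) in gf
  ... | false = refl
  ... | true with uniq zero (suc f) (subst T (sym g₀) tt) (subst T (sym gf) tt)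
  ... | ()

update : ∀ {n} → Fin n → Bool → (Fin n → Bool) → Fin n → Bool
update a x g f = if does (f Fin.≟ a) then x else g f

count-update : ∀ n a x (g : Fin n → Bool) → count n (update a x g) + ind (g a) ≡ count n g + ind x
count-update (suc n) zero x g = swap-ends (ind x) (count n (g ∘ suc)) (ind (g zero))
  where
  swap-ends : ∀ p q r → p + q + r ≡ r + q + p
  swap-ends = solve-∀
count-update (suc n) (suc a) x g = begin
  ind (g zero) + count n (update a x (g ∘ suc)) + ind (g (suc a)) ≡⟨ +-assoc (ind (g zero)) _ _ ⟩
  ind (g zero) + (count n (update a x (g ∘ suc)) + ind (g (suc a))) ≡⟨ cong (ind (g zero) +_) (count-update n a x (g ∘ suc)) ⟩
  ind (g zero) + (count n (g ∘ suc) + ind x) ≡⟨ +-assoc (ind (g zero)) _ _ ⟨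
  ind (g zero) + count n (g ∘ suc) + ind x ∎
  where open ≡-Reasoning

count-select : ∀ n (g : Fin n → Bool) j → j ≤ count n g →
  ∃[ h ] ((∀ f → T (h f) → T (g f)) × count n h ≡ j)
count-select zero    g zero    z≤n = g , (λ f p → p) , refl
count-select (suc n) g zero    _   = (λ _ → false) , (λ f ()) , count-false (suc n)
count-select (suc n) g (suc j) j<c with g zero in g₀
... | false with count-select n (g ∘ suc) (suc j) j<c
...   | h , h⊆g , ch = (false ∷ᶠ h) , below , ch
  where
  below : ∀ f → T ((false ∷ᶠ h) f) → T (g f)
  below zero    ()
  below (suc f) p = h⊆g f p
count-select (suc n) g (suc j) (s≤s j≤c) | true with count-select n (g ∘ suc) j j≤c
...   | h , h⊆g , ch = (true ∷ᶠ h) , below , cong suc ch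
  where
  below : ∀ f → T ((true ∷ᶠ h) f) → T (g f)
  below zero    _ = subst T (sym g₀) tt
  below (suc f) p = h⊆g f p

count-below : ∀ n k → count n (λ f → toℕ f <ᵇ k) ≤ k
count-below zero    k       = z≤n
count-below (suc n) zero    = ≤-reflexive (count-false n)
count-below (suc n) (suc k) = s≤s (count-below n k)

count-above : ∀ n k → count n (λ f → not (toℕ f <ᵇ k)) ≤ n ∸ k
count-above zero    k       = z≤n
count-above (suc n) zero    = ≤-reflexive (count-true (suc n))
count-above (suc n) (suc k) = count-above n k

if-true : ∀ {A : Set} {b} {x y : A} → T b → (if b then x else y) ≡ x
if-true {b = true} _ = refl

if-below : ∀ {A : Set} {a b : A} x t → x < t → (if x <ᵇ t then a else b) ≡ a
if-below x t x<t = if-true (<⇒<ᵇ x<t)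

if-above : ∀ {A : Set} {a b : A} x t → t ≤ x → (if x <ᵇ t then a else b) ≡ b
if-above x t t≤x with x <ᵇ t in lt
... | false = refl
... | true  = ⊥-elim (<⇒≱ (<ᵇ⇒< x t (subst T (sym lt) tt)) t≤x)

-- Cutting the variable order of a DAG at threshold t: the variables of rank
-- below t are early, the others late.
module Cut {V : Set} (rank : V → ℕ) (t : ℕ) where

  splice : (V → Bool) → (V → Bool) → V → Bool
  splice α β v = if rank v <ᵇ t then α v else β v

  splice-early : ∀ α β v → rank v < t → splice α β v ≡ α v
  splice-early α β v v<t = if-below (rank v) t v<t

  splice-late : ∀ α₁ α₂ β v → t ≤ rank v → splice α₁ β v ≡ splice α₂ β v
  splice-late α₁ α₂ β v t≤v = trans (if-above (rank v) t t≤v) (sym (if-above (rank v) t t≤v))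

  Late : ∀ {k} → Dag V k → Child k → Set
  Late d (inj₁ _) = ⊤
  Late d (inj₂ j) = t ≤ rank (varAt d j)

  weaken : ∀ {k} → Child k → Child (suc k)
  weaken (inj₁ b) = inj₁ b
  weaken (inj₂ j) = inj₂ (suc j)

  branch : ∀ {k} → Bool → Node V k → Child k
  branch b nd = if b then Node.hi nd else Node.lo nd

  -- Follow γ from c through the nodes testing early variables; the result is
  -- the child where the evaluation crosses the cut.
  frontier : ∀ {k} → Dag V k → (V → Bool) → Child k → Child k
  frontier d        γ (inj₁ b)       = inj₁ b
  frontier (nd ∷ d) γ (inj₂ zero)    with t ≤? rank (Node.var nd)
  ... | yes _ = inj₂ zero
  ... | no  _ = weaken (frontier d γ (branch (γ (Node.var nd)) nd))
  frontier (nd ∷ d) γ (inj₂ (suc j)) = weaken (frontier d γ (inj₂ j))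

  eval-weaken : ∀ {k} (nd : Node V k) d σ c → evalChild (nd ∷ d) σ (weaken c) ≡ evalChild d σ c
  eval-weaken nd d σ (inj₁ _) = refl
  eval-weaken nd d σ (inj₂ _) = refl

  late-weaken : ∀ {k} (nd : Node V k) d c → Late d c → Late (nd ∷ d) (weaken c)
  late-weaken nd d (inj₁ _) l = l
  late-weaken nd d (inj₂ _) l = l

  eval-top : ∀ {k} (nd : Node V k) d σ →
    evalChild (nd ∷ d) σ (inj₂ zero) ≡ evalChild d σ (branch (σ (Node.var nd)) nd)
  eval-top nd d σ with σ (Node.var nd)
  ... | true  = refl
  ... | false = refl

  frontier-late : ∀ {k} (d : Dag V k) γ c → Late d (frontier d γ c)
  frontier-late d        γ (inj₁ _)       = tt
  frontier-late (nd ∷ d) γ (inj₂ zero)    with t ≤? rank (Node.var nd)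
  ... | yes t≤v = t≤v
  ... | no  _   = late-weaken nd d (frontier d γ (branch (γ (Node.var nd)) nd))
                                  (frontier-late d γ (branch (γ (Node.var nd)) nd))
  frontier-late (nd ∷ d) γ (inj₂ (suc j)) = late-weaken nd d (frontier d γ (inj₂ j)) (frontier-late d γ (inj₂ j))

  frontier-eval : ∀ {k} (d : Dag V k) γ σ → (∀ v → rank v < t → σ v ≡ γ v) → ∀ c →
    evalChild d σ c ≡ evalChild d σ (frontier d γ c)
  frontier-eval d        γ σ σ≈γ (inj₁ _)       = refl
  frontier-eval (nd ∷ d) γ σ σ≈γ (inj₂ zero)    with t ≤? rank (Node.var nd)
  ... | yes _   = refl
  ... | no  t≰v = begin
    evalChild (nd ∷ d) σ (inj₂ zero)                         ≡⟨ eval-top nd d σ ⟩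
    evalChild d σ (branch (σ (Node.var nd)) nd)               ≡⟨ cong (λ b → evalChild d σ (branch b nd)) (σ≈γ _ (≰⇒> t≰v)) ⟩
    evalChild d σ (branch (γ (Node.var nd)) nd)               ≡⟨ frontier-eval d γ σ σ≈γ (branch (γ (Node.var nd)) nd) ⟩
    evalChild d σ (frontier d γ (branch (γ (Node.var nd)) nd)) ≡⟨ eval-weaken nd d σ (frontier d γ (branch (γ (Node.var nd)) nd)) ⟨
    evalChild (nd ∷ d) σ (weaken (frontier d γ (branch (γ (Node.var nd)) nd))) ∎
    where open ≡-Reasoning
  frontier-eval (nd ∷ d) γ σ σ≈γ (inj₂ (suc j)) =
    trans (frontier-eval d γ σ σ≈γ (inj₂ j)) (sym (eval-weaken nd d σ (frontier d γ (inj₂ j))))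

  branch-late : ∀ {k} (d : Dag V k) (nd : Node V k) b → ChildOK rank d (Node.var nd) (Node.lo nd) →
    ChildOK rank d (Node.var nd) (Node.hi nd) → t ≤ rank (Node.var nd) → Late d (branch b nd)
  branch-late d nd true  lo hi t≤v with Node.hi nd
  ... | inj₁ _ = tt
  ... | inj₂ _ = ≤-trans t≤v (<⇒≤ hi)
  branch-late d nd false lo hi t≤v with Node.lo nd
  ... | inj₁ _ = tt
  ... | inj₂ _ = ≤-trans t≤v (<⇒≤ lo)

  eval-late : ∀ {k} (d : Dag V k) → Ordered rank d → ∀ σ₁ σ₂ → (∀ v → t ≤ rank v → σ₁ v ≡ σ₂ v) →
    ∀ c → Late d c → evalChild d σ₁ c ≡ evalChild d σ₂ c
  eval-late d o σ₁ σ₂ σ₁≈σ₂ (inj₁ _) l = refl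
  eval-late (nd ∷ d) (o , lo , hi) σ₁ σ₂ σ₁≈σ₂ (inj₂ zero) l = begin
    evalChild (nd ∷ d) σ₁ (inj₂ zero)            ≡⟨ eval-top nd d σ₁ ⟩
    evalChild d σ₁ (branch (σ₁ (Node.var nd)) nd) ≡⟨ cong (λ b → evalChild d σ₁ (branch b nd)) (σ₁≈σ₂ _ l) ⟩
    evalChild d σ₁ (branch (σ₂ (Node.var nd)) nd) ≡⟨ eval-late d o σ₁ σ₂ σ₁≈σ₂ (branch (σ₂ (Node.var nd)) nd)
                                                       (branch-late d nd (σ₂ (Node.var nd)) lo hi l) ⟩
    evalChild d σ₂ (branch (σ₂ (Node.var nd)) nd) ≡⟨ eval-top nd d σ₂ ⟨
    evalChild (nd ∷ d) σ₂ (inj₂ zero)            ∎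
    where open ≡-Reasoning
  eval-late (nd ∷ d) (o , _ , _) σ₁ σ₂ σ₁≈σ₂ (inj₂ (suc j)) l = eval-late d o σ₁ σ₂ σ₁≈σ₂ (inj₂ j) l

code : ∀ {k} → Child k → Fin (2 + k)
code (inj₁ false) = zero
code (inj₁ true)  = suc zero
code (inj₂ j)     = suc (suc j)

decode : ∀ {k} → Fin (2 + k) → Child k
decode zero          = inj₁ false
decode (suc zero)    = inj₁ true
decode (suc (suc j)) = inj₂ j

decode-code : ∀ {k} (c : Child k) → decode (code c) ≡ c
decode-code (inj₁ false) = refl
decode-code (inj₁ true)  = refl
decode-code (inj₂ j)     = refl

code-injective : ∀ {k} {c c′ : Child k} → code c ≡ code c′ → c ≡ c′
code-injective {c = c} {c′} eq = trans (sym (decode-code c)) (trans (cong decode eq) (decode-code c′))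

-- Fooling-set bound.  If N early assignments are pairwise separated by a
-- common late completion, their frontiers are pairwise distinct children of
-- the DAG, so N ≤ 2 + (number of nodes).
fooling-bound : ∀ {V} (B : OBDD V) (f : (V → Bool) → Bool) → Computes B f → ∀ t {N} (α : Fin N → V → Bool) →
  (∀ i j → ¬ i ≡ j → ∃[ β ] ¬ f (Cut.splice (OBDD.rank B) t (α i) β) ≡ f (Cut.splice (OBDD.rank B) t (α j) β)) →
  N ≤ 2 + OBDD.nodes B
fooling-bound B f computes t {N} α separated = Finₚ.injective⇒≤ {f = code ∘ reach} reach-injective
  where
  open OBDD B
  open Cut rank t

  reach : Fin N → Child nodes
  reach i = frontier dag (α i) root

  same-value : ∀ i j β → reach i ≡ reach j → f (splice (α i) β) ≡ f (splice (α j) β)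
  same-value i j β eq = begin
    f (splice (α i) β)                         ≡⟨ computes _ ⟨
    evalChild dag (splice (α i) β) root        ≡⟨ frontier-eval dag (α i) _ (splice-early (α i) β) root ⟩
    evalChild dag (splice (α i) β) (reach i)   ≡⟨ cong (evalChild dag _) eq ⟩
    evalChild dag (splice (α i) β) (reach j)   ≡⟨ eval-late dag ordered _ _ (splice-late (α i) (α j) β) (reach j)
                                                               (frontier-late dag (α j) root) ⟩
    evalChild dag (splice (α j) β) (reach j)   ≡⟨ frontier-eval dag (α j) _ (splice-early (α j) β) root ⟨
    evalChild dag (splice (α j) β) root        ≡⟨ computes _ ⟩
    f (splice (α j) β)                         ∎
    where open ≡-Reasoning

  reach-injective : Injective _≡_ _≡_ (code ∘ reach)
  reach-injective {i} {j} eq with i Fin.≟ j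
  ... | yes i≡j = i≡j
  ... | no  i≢j with separated i j i≢j
  ...   | β , differ = ⊥-elim (differ (same-value i j β (code-injective eq)))

sum-indicators : ∀ {A : Set} n (e : Fin n → A) (g : A → Bool) →
  sum (map (λ a → if g a then 1 else 0) (tabulate e)) ≡ count n (g ∘ e)
sum-indicators zero    e g = refl
sum-indicators (suc n) e g with g (e zero)
... | true  = cong suc (sum-indicators n (e ∘ suc) g)
... | false = sum-indicators n (e ∘ suc) g

xsum-count : ∀ n ρ → xsum n ρ ≡ count n (λ f → ρ (inj₁ f))
xsum-count n ρ = sum-indicators n (λ f → f) (λ f → ρ (inj₁ f))

toFin-toℕ : ∀ n (f : Fin n) → toFin n (toℕ f) ≡ just f
toFin-toℕ (suc n) zero    = refl
toFin-toℕ (suc n) (suc f) rewrite toFin-toℕ n f = refl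

or-guarded : ∀ s (H : ℕ → Bool) xs → or (map (λ i → (s ≡ᵇ i) ∧ H i) xs) ≡ any (s ≡ᵇ_) xs ∧ H s
or-guarded s H []       = refl
or-guarded s H (i ∷ xs) with s ≡ᵇ i in s≡i
... | false = or-guarded s H xs
... | true rewrite or-guarded s H xs | ≡ᵇ⇒≡ s i (subst T (sym s≡i) _) = absorb (H i) (any (i ≡ᵇ_) xs)
  where
  absorb : ∀ x a → x ∨ (a ∧ x) ≡ x
  absorb true  a     = refl
  absorb false true  = refl
  absorb false false = refl

middle-term : ∀ s i x y →
  (((s ≡ᵇ i) ∧ not x) ∧ not y) ∨ (((s ≡ᵇ i) ∧ x) ∧ y) ≡ (s ≡ᵇ i) ∧ ((not x ∧ not y) ∨ (x ∧ y))
middle-term s i x y with s ≡ᵇ i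
... | true  = refl
... | false = refl

-- The top level n is not a middle level.
≡ᵇ-< : ∀ a b → a < b → (a ≡ᵇ b) ≡ false
≡ᵇ-< a b a<b with a ≡ᵇ b in a≡b
... | false = refl
... | true with ≡ᵇ⇒≡ a b (subst T (sym a≡b) _)
...   | refl = contradiction a<b (<-irrefl refl)

xnor : ∀ x y → ((not x ∧ not y) ∨ (x ∧ y)) ≡ (if x then y else not y)
xnor true  y = refl
xnor false y = ∨-identityʳ (not y)

F-middle : ∀ n ρ (f : Fin n) → xsum n ρ ≡ suc (toℕ f) → suc (toℕ f) < n →
  F n ρ ≡ (if ρ (inj₁ f) then ρ (inj₂ (suc f)) else not (ρ (inj₂ (suc f))))
F-middle n ρ f level i<n = begin
    F n ρ
  ≡⟨ cong₂ _∨_ outer-zero (cong (_∨ or (map G (middle n ρ))) outer-top) ⟩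
    or (map G (middle n ρ))
  ≡⟨ cong or (map-cong (λ i → middle-term s i (xv n ρ i) (yv n ρ i)) (middle n ρ)) ⟩
    or (map (λ i → (s ≡ᵇ i) ∧ H i) (middle n ρ))
  ≡⟨ or-guarded s H (middle n ρ) ⟩
    any (s ≡ᵇ_) (middle n ρ) ∧ H s
  ≡⟨ cong (_∧ H s) (Equivalence.to T-≡ (any⁺ (s ≡ᵇ_) (Any.map (≡⇒≡ᵇ s _) s∈middle))) ⟩
    H s
  ≡⟨ H-level ⟩
    (if ρ (inj₁ f) then ρ (inj₂ (suc f)) else not (ρ (inj₂ (suc f))))
  ∎
  where
  open ≡-Reasoning
  s = xsum n ρ
  G H : ℕ → Bool
  G i = (Pi0 n ρ i ∧ not (yv n ρ i)) ∨ (Pi1 n ρ i ∧ yv n ρ i)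
  H i = (not (xv n ρ i) ∧ not (yv n ρ i)) ∨ (xv n ρ i ∧ yv n ρ i)
  outer-zero : (P₀ n ρ ∧ not (yv n ρ 0)) ≡ false
  outer-zero rewrite level = refl
  outer-top : (Pₙ n ρ ∧ yv n ρ n) ≡ false
  outer-top rewrite level | ≡ᵇ-< (suc (toℕ f)) n i<n = refl
  s∈middle : s ∈ middle n ρ
  s∈middle rewrite level = ∈-map⁺ suc (∈-upTo⁺ (≤-trans (s≤s ≤-refl) (∸-monoˡ-≤ 1 i<n)))
  H-level : H s ≡ (if ρ (inj₁ f) then ρ (inj₂ (suc f)) else not (ρ (inj₂ (suc f))))
  H-level rewrite level | toFin-toℕ n f = xnor (ρ (inj₁ f)) (ρ (inj₂ (suc f)))

module _ {n : ℕ} where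

  pairs : ∀ {m} → List (Fin n) → Vec Bool m → (Fin n → Bool) → Fin n → Bool
  pairs []          v       d = d
  pairs (a ∷ [])    v       d = d
  pairs (a ∷ b ∷ L) []      d = d
  pairs (a ∷ b ∷ L) (x ∷ v) d = update a x (update b (not x) (pairs L v d))

  update-same : ∀ a x (g : Fin n → Bool) → update a x g a ≡ x
  update-same a x g rewrite dec-true (a Fin.≟ a) refl = refl

  update-other : ∀ a x (g : Fin n → Bool) f → ¬ f ≡ a → update a x g f ≡ g f
  update-other a x g f f≢a rewrite dec-false (f Fin.≟ a) f≢a = refl

  pairs-outside : ∀ {m} L (v : Vec Bool m) d f → f ∉ L → pairs L v d f ≡ d f
  pairs-outside []          v       d f f∉L = refl
  pairs-outside (a ∷ [])    v       d f f∉L = refl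
  pairs-outside (a ∷ b ∷ L) []      d f f∉L = refl
  pairs-outside (a ∷ b ∷ L) (x ∷ v) d f f∉L = begin
    update a x (update b (not x) (pairs L v d)) f ≡⟨ update-other a x (update b (not x) (pairs L v d)) f (f∉L ∘ here) ⟩
    update b (not x) (pairs L v d) f             ≡⟨ update-other b (not x) (pairs L v d) f (f∉L ∘ there ∘ here) ⟩
    pairs L v d f                                ≡⟨ pairs-outside L v d f (f∉L ∘ there ∘ there) ⟩
    d f                                          ∎
    where open ≡-Reasoning

  shorter : ∀ {m k} → 2 * suc m ≤ suc (suc k) → 2 * m ≤ k
  shorter {m} {k} le = ≤-pred (≤-pred (subst (_≤ suc (suc k)) (cong suc (+-suc m (m + 0))) le))

  too-short : ∀ {m} → ¬ 2 * suc m ≤ 1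
  too-short {m} (s≤s le) with subst (_≤ 0) (+-suc m (m + 0)) le
  ... | ()

  pairs-separate : ∀ {m} L (v w : Vec Bool m) d → ¬ v ≡ w → 2 * m ≤ length L → Unique L →
    ∃[ f ] (f ∈ L × ¬ pairs L v d f ≡ pairs L w d f)
  pairs-separate L           []      []      d v≢w _ _ = ⊥-elim (v≢w refl)
  pairs-separate []          (x ∷ v) (y ∷ w) d v≢w () _
  pairs-separate (a ∷ [])    (x ∷ v) (y ∷ w) d v≢w le _ = ⊥-elim (too-short le)
  pairs-separate (a ∷ b ∷ L) (x ∷ v) (y ∷ w) d v≢w le ((_ All.∷ a∉L) ∷ (b∉L ∷ uniqueL)) with x Bool.≟ y
  ... | no x≢y = a , here refl , λ same → x≢y (trans (sym (update-same a x (update b (not x) (pairs L v d))))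
                                                (trans same (update-same a y (update b (not y) (pairs L w d)))))
  ... | yes refl with pairs-separate L v w d (λ v≡w → v≢w (cong (x ∷_) v≡w)) (shorter le) uniqueL
  ...   | f , f∈L , differ = f , there (there f∈L) , λ same → differ (trans (sym (inner v)) (trans same (inner w)))
    where
    inner : ∀ u → pairs (a ∷ b ∷ L) (x ∷ u) d f ≡ pairs L u d f
    inner u = trans (update-other a x (update b (not x) (pairs L u d)) f (λ f≡a → All.lookup a∉L f∈L (sym f≡a)))
                    (update-other b (not x) (pairs L u d) f (λ f≡b → All.lookup b∉L f∈L (sym f≡b)))

  ind-not : ∀ x → ind x + ind (not x) ≡ 1
  ind-not true  = refl
  ind-not false = refl

  -- Weight of a code: each pair contributes exactly one true value, replacing
  -- two default values b.  So the weight does not depend on v.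
  pairs-count : ∀ {m} L (v : Vec Bool m) d b → 2 * m ≤ length L → Unique L → (∀ f → f ∈ L → d f ≡ b) →
    count n (pairs L v d) + ind b * (2 * m) ≡ count n d + m
  pairs-count L []      d b _  _       _       = begin
    count n (pairs L [] d) + ind b * 0 ≡⟨ cong₂ _+_ (count-ext n (pairs-nil L)) (*-zeroʳ (ind b)) ⟩
    count n d + 0                      ∎
    where
    open ≡-Reasoning
    pairs-nil : ∀ L f → pairs L [] d f ≡ d f
    pairs-nil []          f = refl
    pairs-nil (a ∷ [])    f = refl
    pairs-nil (a ∷ b ∷ L) f = refl
  pairs-count []           (x ∷ v) d b () _ _
  pairs-count (a ∷ [])     (x ∷ v) d b le _ _ = ⊥-elim (too-short le)
  pairs-count {suc m} (a ∷ a′ ∷ L) (x ∷ v) d b le ((a≢a′ All.∷ a∉L) ∷ (a′∉L ∷ uniqueL)) default = begin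
    count n I + β * (2 * suc m)                      ≡⟨ regroup₁ (count n I) β m ⟩
    ((count n I + β) + β) + β * (2 * m)              ≡⟨ cong (λ z → (z + β) + β * (2 * m)) step₁ ⟩
    ((count n H + ind x) + β) + β * (2 * m)          ≡⟨ regroup₂ (count n H) (ind x) β (β * (2 * m)) ⟩
    ((count n H + β) + ind x) + β * (2 * m)          ≡⟨ cong (λ z → (z + ind x) + β * (2 * m)) step₂ ⟩
    ((count n G + ind (not x)) + ind x) + β * (2 * m) ≡⟨ regroup₃ (count n G) (ind (not x)) (ind x) (β * (2 * m)) ⟩
    (count n G + β * (2 * m)) + (ind x + ind (not x)) ≡⟨ cong₂ _+_ ih (ind-not x) ⟩
    (count n d + m) + 1                              ≡⟨ regroup₄ (count n d) m ⟩
    count n d + suc m                                ∎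
    where
    open ≡-Reasoning
    β = ind b
    G H I : Fin n → Bool
    G = pairs L v d
    H = update a′ (not x) G
    I = update a x H
    H-at-a : H a ≡ b
    H-at-a = trans (update-other a′ (not x) G a a≢a′)
             (trans (pairs-outside L v d a (All¬⇒¬Any a∉L)) (default a (here refl)))
    G-at-a′ : G a′ ≡ b
    G-at-a′ = trans (pairs-outside L v d a′ (All¬⇒¬Any a′∉L)) (default a′ (there (here refl)))
    step₁ : count n I + β ≡ count n H + ind x
    step₁ = subst (λ y → count n I + ind y ≡ count n H + ind x) H-at-a (count-update n a x H)
    step₂ : count n H + β ≡ count n G + ind (not x)
    step₂ = subst (λ y → count n H + ind y ≡ count n G + ind (not x)) G-at-a′ (count-update n a′ (not x) G)
    ih : count n G + β * (2 * m) ≡ count n d + m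
    ih = pairs-count L v d b (shorter le) uniqueL (λ f f∈L → default f (there (there f∈L)))
    regroup₁ : ∀ i β m → i + β * (2 * suc m) ≡ ((i + β) + β) + β * (2 * m)
    regroup₁ = solve-∀
    regroup₂ : ∀ h y β r → ((h + y) + β) + r ≡ ((h + β) + y) + r
    regroup₂ = solve-∀
    regroup₃ : ∀ g y x r → ((g + y) + x) + r ≡ (g + r) + (x + y)
    regroup₃ = solve-∀
    regroup₄ : ∀ c m → (c + m) + 1 ≡ c + suc m
    regroup₄ = solve-∀

-- Binary expansion: an injection Fin (2 ^ m) → {0,1}^m, defined through the
-- splitting of Fin (2 ^ suc m) into two halves (leading digit 0 or 1).
bits : ∀ m → Fin (2 ^ m) → Vec Bool m
bits-half : ∀ m → Fin (2 ^ m) ⊎ Fin (2 ^ m + 0) → Vec Bool (suc m)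
bits zero    _ = []
bits (suc m) i = bits-half m (splitAt (2 ^ m) i)
bits-half m (inj₁ j) = false ∷ bits m j
bits-half m (inj₂ j) = true  ∷ bits m (subst Fin (+-identityʳ (2 ^ m)) j)

bits-injective : ∀ m {i j} → bits m i ≡ bits m j → i ≡ j
bits-half-injective : ∀ m x y → bits-half m x ≡ bits-half m y → x ≡ y
bits-injective zero    {zero} {zero} _ = refl
bits-injective (suc m) {i} {j} eq = begin
  i                                            ≡⟨ Finₚ.join-splitAt (2 ^ m) (2 ^ m + 0) i ⟨
  join (2 ^ m) (2 ^ m + 0) (splitAt (2 ^ m) i) ≡⟨ cong (join (2 ^ m) (2 ^ m + 0)) (bits-half-injective m _ _ eq) ⟩
  join (2 ^ m) (2 ^ m + 0) (splitAt (2 ^ m) j) ≡⟨ Finₚ.join-splitAt (2 ^ m) (2 ^ m + 0) j ⟩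
  j                                            ∎
  where open ≡-Reasoning
bits-half-injective m (inj₁ x) (inj₁ y) eq = cong inj₁ (bits-injective m (Vecₚ.∷-injectiveʳ eq))
bits-half-injective m (inj₂ x) (inj₂ y) eq =
  cong inj₂ (subst-injective (+-identityʳ (2 ^ m)) (bits-injective m (Vecₚ.∷-injectiveʳ eq)))
bits-half-injective m (inj₁ x) (inj₂ y) ()
bits-half-injective m (inj₂ x) (inj₁ y) ()

not-as-if : ∀ x → (if x then false else true) ≡ not x
not-as-if true  = refl
not-as-if false = refl

module AtCut {n : ℕ} (B : OBDD (Var n)) (t : ℕ) where
  open OBDD B using (rank; nodes)
  open Cut rank t using (splice)

  early : Fin n → Bool
  early f = rank (inj₁ f) <ᵇ t

  late : ℕ
  late = count n (not ∘ early)

  -- A window of width m at the cut: 2m distinct early positions, to be paired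
  -- up, and a default value for the other early x-variables such that every
  -- pair code has weight `offset`, and every level f+1 of a position can be
  -- reached from `offset` by switching on late variables, strictly below n.
  record Window (m : ℕ) : Set where
    field
      positions : List (Fin n)
      distinct  : Unique positions
      enough    : 2 * m ≤ length positions
      default   : Bool
      offset    : ℕ
      weight    : count n (λ f → early f ∧ default) + m ≡ offset + ind default * (2 * m)
      inside    : ∀ f → f ∈ positions →
                  T (early f) × offset ≤ suc (toℕ f) × suc (toℕ f) ≤ offset + late × suc (toℕ f) < n

  -- A window of width m is a fooling set of size 2^m for any OBDD computing F_n.
  window-bound : Computes B (F n) → ∀ {m} → Window m → 2 ^ m ≤ 2 + nodes
  window-bound computes {m} w = fooling-bound B (F n) computes t α separated
    where
    open Window w
    d : Fin n → Bool
    d f = early f ∧ default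

    α : Fin (2 ^ m) → Var n → Bool
    α i (inj₁ f) = pairs positions (bits m i) d f
    α i (inj₂ _) = false

    completion : (Fin n → Bool) → Var n → Bool
    completion h (inj₁ f) = h f
    completion h (inj₂ _) = false

    code-weight : ∀ v → count n (pairs positions v d) ≡ offset
    code-weight v = +-cancelʳ-≡ (ind default * (2 * m)) _ _
      (trans (pairs-count positions v d default enough distinct on-positions) weight)
      where
      on-positions : ∀ f → f ∈ positions → d f ≡ default
      on-positions f f∈L with early f | proj₁ (inside f f∈L)
      ... | true | _ = refl

    -- With a late completion h raising the x-sum to the level f + 1 of a
    -- position f, F_n reads off the negated code bit at f.
    value-at : ∀ i h f → f ∈ positions → (∀ g → T (h g) → T (not (early g))) →
      count n h ≡ suc (toℕ f) ∸ offset → F n (splice (α i) (completion h)) ≡ not (pairs positions (bits m i) d f)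
    value-at i h f f∈L h-late h-count = begin
      F n ρ                                                         ≡⟨ F-middle n ρ f level f<n ⟩
      (if ρ (inj₁ f) then ρ (inj₂ (suc f)) else not (ρ (inj₂ (suc f)))) ≡⟨ cong₂ (λ x y → if x then y else not y)
                                                                              (if-true f-early) (if-eta (rank (inj₂ (suc f)) <ᵇ t)) ⟩
      (if P f then false else true)                                  ≡⟨ not-as-if (P f) ⟩
      not (P f)                                                      ∎
      where
      open ≡-Reasoning
      ρ = splice (α i) (completion h)
      P = pairs positions (bits m i) d
      f-early   = proj₁ (inside f f∈L)
      offset≤   = proj₁ (proj₂ (inside f f∈L))
      f<n       = proj₂ (proj₂ (proj₂ (inside f f∈L)))
      early-part : ∀ g → (early g ∧ ρ (inj₁ g)) ≡ P g
      early-part g with early g in eg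
      ... | true  = refl
      ... | false = sym (trans (pairs-outside positions (bits m i) d g (λ g∈L → subst T eg (proj₁ (inside g g∈L))))
                               (cong (_∧ default) eg))
      late-part : ∀ g → (not (early g) ∧ ρ (inj₁ g)) ≡ h g
      late-part g with early g in eg | h g in hg
      ... | false | _     = refl
      ... | true  | false = refl
      ... | true  | true  = ⊥-elim (subst (T ∘ not) eg (h-late g (subst T (sym hg) tt)))
      level : xsum n ρ ≡ suc (toℕ f)
      level = begin
          xsum n ρ
        ≡⟨ xsum-count n ρ ⟩
          count n (ρ ∘ inj₁)
        ≡⟨ count-split n early (ρ ∘ inj₁) ⟩
          count n (λ g → early g ∧ ρ (inj₁ g)) + count n (λ g → not (early g) ∧ ρ (inj₁ g))
        ≡⟨ cong₂ _+_ (count-ext n early-part) (count-ext n late-part) ⟩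
          count n P + count n h
        ≡⟨ cong₂ _+_ (code-weight (bits m i)) h-count ⟩
          offset + (suc (toℕ f) ∸ offset)
        ≡⟨ m+[n∸m]≡n offset≤ ⟩
          suc (toℕ f)
        ∎

    -- distinct codes differ at a position f; switch on just enough late
    -- variables to reach level f + 1
    separated : ∀ i j → ¬ i ≡ j →
      ∃[ β ] ¬ F n (splice (α i) β) ≡ F n (splice (α j) β)
    separated i j i≢j with pairs-separate positions (bits m i) (bits m j) d (i≢j ∘ bits-injective m) enough distinct
    ... | f , f∈L , differ with count-select n (not ∘ early) (suc (toℕ f) ∸ offset)
                                  (m≤n+o⇒m∸n≤o (suc (toℕ f)) offset (proj₁ (proj₂ (proj₂ (inside f f∈L)))))
    ...   | h , h-late , h-count = completion h , λ same → differ (not-injective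
              (trans (sym (value-at i h f f∈L h-late h-count)) (trans same (value-at j h f f∈L h-late h-count))))

length-filter-tabulate : ∀ {A : Set} k (e : Fin k → A) (g : A → Bool) →
  length (filter (T? ∘ g) (tabulate e)) ≡ count k (g ∘ e)
length-filter-tabulate zero    e g = refl
length-filter-tabulate (suc k) e g with g (e zero)
... | true  = cong suc (length-filter-tabulate k (e ∘ suc) g)
... | false = length-filter-tabulate k (e ∘ suc) g

T-∧ : ∀ {a b} → T (a ∧ b) → T a × T b
T-∧ {true} {true} _ = tt , tt

T-not-<ᵇ : ∀ x k → T (not (x <ᵇ k)) → k ≤ x
T-not-<ᵇ x k h with x <ᵇ k in lt
... | false = ≮⇒≥ (λ x<k → subst T lt (<⇒<ᵇ x<k))

module Selection {n : ℕ} (B : OBDD (Var n)) (t : ℕ) where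
  open AtCut B t

  window-from : ∀ {m} (W : Fin n → Bool) b c → 2 * m ≤ count n W →
    count n (λ f → early f ∧ b) + m ≡ c + ind b * (2 * m) →
    (∀ f → T (W f) → T (early f) × c ≤ suc (toℕ f) × suc (toℕ f) ≤ c + late × suc (toℕ f) < n) →
    Window m
  window-from W b c enough weight admissible = record
    { positions = filter (T? ∘ W) (allFin n)
    ; distinct  = filter⁺ (T? ∘ W) (allFin⁺ n)
    ; enough    = subst (_ ≤_) (sym (length-filter-tabulate n (λ f → f) W)) enough
    ; default   = b
    ; offset    = c
    ; weight    = weight
    ; inside    = λ f f∈L → admissible f (proj₂ (∈-filter⁻ (T? ∘ W) {xs = allFin n} f∈L))
    }

  module _ (m : ℕ) (eight-m-early : count n early ≡ 8 * m) (16m≤n : 16 * m ≤ n) (1≤m : 1 ≤ m) where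

    low : Fin n → Bool
    low f = toℕ f <ᵇ 8 * m

    low-early : ℕ
    low-early = count n (λ f → low f ∧ early f)

    n≡8m+late : 8 * m + late ≡ n
    n≡8m+late = begin
        8 * m + late
      ≡⟨ cong (_+ late) eight-m-early ⟨
        count n early + late
      ≡⟨ cong₂ _+_ (count-ext n (λ f → sym (∧-identityʳ (early f))))
                   (count-ext n (λ f → sym (∧-identityʳ (not (early f))))) ⟩
        count n (λ f → early f ∧ true) + count n (λ f → not (early f) ∧ true)
      ≡⟨ count-split n early (λ _ → true) ⟨
        count n (λ _ → true)
      ≡⟨ count-true n ⟩
        n
      ∎
      where open ≡-Reasoning

    8m≤late : 8 * m ≤ late
    8m≤late = +-cancelˡ-≤ (8 * m) (8 * m) late
      (≤-trans (≤-reflexive (double m)) (≤-trans 16m≤n (≤-reflexive (sym n≡8m+late))))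
      where
      double : ∀ m → 8 * m + 8 * m ≡ 16 * m
      double = solve-∀

    8m<n : 8 * m < n
    8m<n = ≤-trans (≤-reflexive (+-comm 1 (8 * m)))
             (≤-trans (+-monoʳ-≤ (8 * m) (≤-trans 1≤m (≤-trans (m≤n*m m 8) 8m≤late))) (≤-reflexive n≡8m+late))

    -- Case 1: at least 4m early positions are low.  Those in [m, 8m) are at
    -- least 3m; with all other early variables off every code weighs m.
    window-low : 4 * m ≤ low-early → Window m
    window-low 4m≤a = window-from W false m enough weight admissible
      where
      W : Fin n → Bool
      W f = early f ∧ (low f ∧ not (toℕ f <ᵇ m))
      cover : ∀ f → T (low f ∧ early f) → T (W f) ⊎ T (toℕ f <ᵇ m)
      cover f _ with toℕ f <ᵇ m | low f | early f
      ... | true  | _    | _    = inj₂ tt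
      ... | false | true | true = inj₁ tt
      enough : 2 * m ≤ count n W
      enough = +-cancelʳ-≤ m (2 * m) (count n W) (begin
        2 * m + m                             ≡⟨ three m ⟩
        3 * m                                 ≤⟨ *-monoˡ-≤ m (n≤1+n 3) ⟩
        4 * m                                 ≤⟨ 4m≤a ⟩
        low-early                             ≤⟨ count-cover n _ W (λ f → toℕ f <ᵇ m) cover ⟩
        count n W + count n (λ f → toℕ f <ᵇ m) ≤⟨ +-monoʳ-≤ (count n W) (count-below n m) ⟩
        count n W + m                         ∎)
        where
        open ≤-Reasoning
        three : ∀ m → 2 * m + m ≡ 3 * m
        three = solve-∀
      weight : count n (λ f → early f ∧ false) + m ≡ m + ind false * (2 * m)
      weight = trans (cong (_+ m) (trans (count-ext n (∧-zeroʳ ∘ early)) (count-false n))) (sym (+-identityʳ m))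
      admissible : ∀ f → T (W f) → T (early f) × m ≤ suc (toℕ f) × suc (toℕ f) ≤ m + late × suc (toℕ f) < n
      admissible f w with T-∧ {early f} w
      ... | is-early , rest with T-∧ {low f} rest
      ...   | is-low , not-below-m =
                is-early
              , m≤n⇒m≤1+n (T-not-<ᵇ (toℕ f) m not-below-m)
              , ≤-trans below-8m (≤-trans 8m≤late (m≤n+m late m))
              , ≤-<-trans below-8m 8m<n
        where
        below-8m : suc (toℕ f) ≤ 8 * m
        below-8m = <ᵇ⇒< (toℕ f) (8 * m) is-low

    -- Case 2: more than 4m early positions are high.  Those in [8m, n - m - 1)
    -- are at least 3m; with all other early variables on every code weighs 7m.
    window-high : ¬ 4 * m ≤ low-early → Window m
    window-high a<4m = window-from W true (7 * m) enough weight admissible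
      where
      k : ℕ
      k = n ∸ suc m
      high-early : ℕ
      high-early = count n (λ f → not (low f) ∧ early f)
      sm≤n : suc m ≤ n
      sm≤n = ≤-trans (s≤s (m≤n*m m 8)) 8m<n
      suc-k : suc k ≡ n ∸ m
      suc-k = sym (+-∸-assoc 1 sm≤n)
      W : Fin n → Bool
      W f = early f ∧ (not (low f) ∧ (toℕ f <ᵇ k))
      cover : ∀ f → T (not (low f) ∧ early f) → T (W f) ⊎ T (not (toℕ f <ᵇ k))
      cover f _ with toℕ f <ᵇ k | low f | early f
      ... | false | _     | _    = inj₂ tt
      ... | true  | false | true = inj₁ tt
      many-high : suc (4 * m) ≤ high-early
      many-high = +-cancelˡ-≤ (4 * m) (suc (4 * m)) high-early (begin
        4 * m + suc (4 * m)       ≡⟨ eight m ⟩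
        suc (8 * m)               ≡⟨ cong suc (trans (sym eight-m-early) (count-split n low early)) ⟩
        suc low-early + high-early ≤⟨ +-monoˡ-≤ high-early (≰⇒> a<4m) ⟩
        4 * m + high-early        ∎)
        where
        open ≤-Reasoning
        eight : ∀ m → 4 * m + suc (4 * m) ≡ suc (8 * m)
        eight = solve-∀
      enough : 2 * m ≤ count n W
      enough = +-cancelʳ-≤ (suc m) (2 * m) (count n W) (begin
        2 * m + suc m                             ≡⟨ three m ⟩
        suc (3 * m)                               ≤⟨ s≤s (*-monoˡ-≤ m (n≤1+n 3)) ⟩
        suc (4 * m)                               ≤⟨ many-high ⟩
        high-early                                ≤⟨ count-cover n _ W (λ f → not (toℕ f <ᵇ k)) cover ⟩
        count n W + count n (λ f → not (toℕ f <ᵇ k)) ≤⟨ +-monoʳ-≤ (count n W) (count-above n k) ⟩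
        count n W + (n ∸ k)                       ≡⟨ cong (count n W +_) (m∸[m∸n]≡n sm≤n) ⟩
        count n W + suc m                         ∎)
        where
        open ≤-Reasoning
        three : ∀ m → 2 * m + suc m ≡ suc (3 * m)
        three = solve-∀
      weight : count n (λ f → early f ∧ true) + m ≡ 7 * m + ind true * (2 * m)
      weight = trans (cong (_+ m) (trans (count-ext n (∧-identityʳ ∘ early)) eight-m-early)) (nine m)
        where
        nine : ∀ m → 8 * m + m ≡ 7 * m + 1 * (2 * m)
        nine = solve-∀
      n∸m≡7m+late : n ∸ m ≡ 7 * m + late
      n∸m≡7m+late = trans (cong (_∸ m) (trans (sym n≡8m+late) (split m late))) (m+n∸m≡n m (7 * m + late))
        where
        split : ∀ m l → 8 * m + l ≡ m + (7 * m + l)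
        split = solve-∀
      admissible : ∀ f → T (W f) → T (early f) × 7 * m ≤ suc (toℕ f) × suc (toℕ f) ≤ 7 * m + late × suc (toℕ f) < n
      admissible f w with T-∧ {early f} w
      ... | is-early , rest with T-∧ {not (low f)} rest
      ...   | not-low , below-k =
                is-early
              , ≤-trans (*-monoˡ-≤ m (n≤1+n 7)) (m≤n⇒m≤1+n (T-not-<ᵇ (toℕ f) (8 * m) not-low))
              , ≤-trans f<k (≤-trans (n≤1+n k) (≤-reflexive (trans suc-k n∸m≡7m+late)))
              , ≤-trans (s≤s f<k) (≤-trans (≤-reflexive suc-k) (m∸n≤m n m))
        where
        f<k : suc (toℕ f) ≤ k
        f<k = <ᵇ⇒< (toℕ f) k below-k

    select-window : Window m
    select-window with 4 * m ≤? low-early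
    ... | yes 4m≤a = window-low 4m≤a
    ... | no  a<4m = window-high a<4m

discrete-ivt : ∀ (q : ℕ → ℕ) T K → q 0 ≡ 0 → (∀ t → q (suc t) ≤ suc (q t)) → K ≤ q T → ∃[ t ] q t ≡ K
discrete-ivt q zero    K q0 step K≤q = 0 , trans q0 (sym (n≤0⇒n≡0 (subst (K ≤_) q0 K≤q)))
discrete-ivt q (suc T) K q0 step K≤q with K ≤? q T
... | yes K≤qT = discrete-ivt q T K q0 step K≤qT
... | no  K≰qT = suc T , ≤-antisym (≤-trans (step T) (≰⇒> K≰qT)) K≤q

bound : ∀ n → (Fin n → ℕ) → ℕ
bound zero    g = 0
bound (suc n) g = g zero ⊔ bound n (g ∘ suc)

bound-≥ : ∀ n g (f : Fin n) → g f ≤ bound n g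
bound-≥ (suc n) g zero    = m≤m⊔n _ _
bound-≥ (suc n) g (suc f) = ≤-trans (bound-≥ n (g ∘ suc) f) (m≤n⊔m _ _)

-- Since the variable order is strict, moving the cut one step past a rank
-- makes at most one more variable early; hence every early count K ≤ n is
-- attained by some cut.
cut-with-early-count : ∀ n (B : OBDD (Var n)) K → K ≤ n → ∃[ t ] count n (AtCut.early B t) ≡ K
cut-with-early-count n B K K≤n = discrete-ivt q (suc (bound n (rank ∘ inj₁))) K q0 step (subst (K ≤_) (sym all-early) K≤n)
  where
  open OBDD B using (rank; rankInj)
  q : ℕ → ℕ
  q t = count n (AtCut.early B t)
  q0 : q 0 ≡ 0
  q0 = count-false n
  all-early : q (suc (bound n (rank ∘ inj₁))) ≡ n
  all-early = trans (count-ext n below-bound) (count-true n)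
    where
    below-bound : ∀ f → (rank (inj₁ f) <ᵇ suc (bound n (rank ∘ inj₁))) ≡ true
    below-bound f with rank (inj₁ f) <ᵇ suc (bound n (rank ∘ inj₁)) in lt
    ... | true  = refl
    ... | false = ⊥-elim (subst T lt (<⇒<ᵇ (s≤s (bound-≥ n (rank ∘ inj₁) f))))
  at-rank : ∀ t f₁ f₂ → T (rank (inj₁ f₁) ≡ᵇ t) → T (rank (inj₁ f₂) ≡ᵇ t) → f₁ ≡ f₂
  at-rank t f₁ f₂ r₁ r₂ = Sumₚ.inj₁-injective (rankInj (trans (≡ᵇ⇒≡ _ t r₁) (sym (≡ᵇ⇒≡ _ t r₂))))
  one-more : ∀ t f → T (rank (inj₁ f) <ᵇ suc t) → T (rank (inj₁ f) <ᵇ t) ⊎ T (rank (inj₁ f) ≡ᵇ t)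
  one-more t f lt with m≤n⇒m<n∨m≡n (<ᵇ⇒< (rank (inj₁ f)) (suc t) lt)
  ... | inj₁ (s≤s r<t) = inj₁ (<⇒<ᵇ r<t)
  ... | inj₂ refl      = inj₂ (≡⇒≡ᵇ t t refl)
  step : ∀ t → q (suc t) ≤ suc (q t)
  step t = begin
    q (suc t)                                      ≤⟨ count-cover n _ _ (λ f → rank (inj₁ f) ≡ᵇ t) (one-more t) ⟩
    q t + count n (λ f → rank (inj₁ f) ≡ᵇ t)       ≤⟨ +-monoʳ-≤ (q t) (count-unique n _ (at-rank t)) ⟩
    q t + 1                                        ≡⟨ +-comm (q t) 1 ⟩
    suc (q t)                                      ∎
    where open ≤-Reasoning

size-arithmetic : ∀ n m N → n ≤ 16 * suc m → 2 ≤ m → 2 ^ m ≤ 2 + N → 2 ^ n ≤ (7 * N) ^ 16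
size-arithmetic n m N n≤ 2≤m 2^m≤ = begin
  2 ^ n                ≤⟨ ^-monoʳ-≤ 2 (≤-trans n≤ (≤-reflexive (*-comm 16 (suc m)))) ⟩
  2 ^ (suc m * 16)     ≡⟨ ^-*-assoc 2 (suc m) 16 ⟨
  (2 ^ suc m) ^ 16     ≤⟨ ^-monoˡ-≤ 16 2^sm≤7N ⟩
  (7 * N) ^ 16         ∎
  where
  open ≤-Reasoning
  2≤N : 2 ≤ N
  2≤N = +-cancelˡ-≤ 2 2 N (≤-trans (^-monoʳ-≤ 2 2≤m) 2^m≤)
  2^sm≤7N : 2 ^ suc m ≤ 7 * N
  2^sm≤7N = begin
    2 * 2 ^ m          ≤⟨ *-monoʳ-≤ 2 2^m≤ ⟩
    2 * (2 + N)        ≡⟨ expand N ⟩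
    2 * 2 + 2 * N      ≤⟨ +-monoˡ-≤ (2 * N) (*-monoʳ-≤ 2 2≤N) ⟩
    2 * N + 2 * N      ≡⟨ double N ⟩
    4 * N              ≤⟨ *-monoˡ-≤ N (+-monoˡ-≤ 4 (z≤n {3})) ⟩
    7 * N              ∎
    where
    expand : ∀ x → 2 * (2 + x) ≡ 2 * 2 + 2 * x
    expand = solve-∀
    double : ∀ x → 2 * x + 2 * x ≡ 4 * x
    double = solve-∀

sixteenths : ∀ n → 32 ≤ n → 2 ≤ n / 16 × 16 * (n / 16) ≤ n × n ≤ 16 * suc (n / 16)
sixteenths n 32≤n = /-monoˡ-≤ 16 32≤n , ≤-trans (≤-reflexive (*-comm 16 (n / 16))) (m/n*n≤m n 16) , upper
  where
  upper : n ≤ 16 * suc (n / 16)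
  upper = begin
    n                        ≡⟨ m≡m%n+[m/n]*n n 16 ⟩
    n % 16 + n / 16 * 16     ≤⟨ +-monoˡ-≤ (n / 16 * 16) (<⇒≤ (m%n<n n 16)) ⟩
    16 + n / 16 * 16         ≡⟨ rearrange (n / 16) ⟩
    16 * suc (n / 16)        ∎
    where
    open ≤-Reasoning
    rearrange : ∀ q → 16 + q * 16 ≡ 16 * suc q
    rearrange = solve-∀

lemma2 : ∃[ c ] ∃[ N ] ((n : ℕ) → N ≤ n → (B : OBDD (Var n)) → Computes B (F n) → 2 ^ n ≤ size B ^ c)
lemma2 = 16 , 32 , bound-for-F
  where
  bound-for-F : (n : ℕ) → 32 ≤ n → (B : OBDD (Var n)) → Computes B (F n) → 2 ^ n ≤ size B ^ 16
  bound-for-F n 32≤n B computes = size-arithmetic n m (OBDD.nodes B) n≤16[m+1] 2≤m nodes-bound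
    where
    m : ℕ
    m = n / 16
    2≤m : 2 ≤ m
    2≤m = proj₁ (sixteenths n 32≤n)
    16m≤n : 16 * m ≤ n
    16m≤n = proj₁ (proj₂ (sixteenths n 32≤n))
    n≤16[m+1] : n ≤ 16 * suc m
    n≤16[m+1] = proj₂ (proj₂ (sixteenths n 32≤n))
    cut : ∃[ t ] count n (AtCut.early B t) ≡ 8 * m
    cut = cut-with-early-count n B (8 * m) (≤-trans (*-monoˡ-≤ m (m≤m+n 8 8)) 16m≤n)
    nodes-bound : 2 ^ m ≤ 2 + OBDD.nodes B
    nodes-bound = AtCut.window-bound B (proj₁ cut) computes
                    (Selection.select-window B (proj₁ cut) m (proj₂ cut) 16m≤n (≤-trans (s≤s z≤n) 2≤m))
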